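{- Let $m$ be a positive integer and $n = 4m-1$. Then $p_n \ge 2 - \frac{1}{3\cdot 2^{m-1}-1}$. Equivalently: there exist real numbers $a_1,\dots,a_n\in[0,1]$ such that for every choice of signs $e_1,\dots,e_n\in\{ -1,+1\}$, with $s_0=0$ and $s_i=\sum_{k=1}^i e_k a_k$ for $1\le i\le n$, we have $\max_{0\le k\le n} s_k - \min_{0\le k\le n} s_k \ge 2 - \frac{1}{3\cdot 2^{m-1}-1}$.
   Context: For a positive integer $n$, signs $e_1,\dots,e_n\in\{ -1,+1\}$ and reals $a_1,\dots,a_n\in[0,1]$, set $s_0=0$ and $s_i=\sum_{k=1}^i e_k a_k$ for $1\le i\le n$. The range is $g(e_1,\dots,e_n,a_1,\dots,a_n)=\max_{0\le k\le n}s_k-\min_{0\le k\le n}s_k$. The step-cover is $f(a_1,\dots,a_n)=\min_{e_1,\dots,e_n\in\{ -1,+1\}} g(e_1,\dots,e_n,a_1,\dots,a_n)$. The fit is $p_n=\max_{a_1,\dots,a_n\in[0,1]} f(a_1,\dots,a_n)$. -}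

module Defs where

open import Data.Bool using (Bool; true; false)
open import Data.Nat as ℕ using (ℕ; suc; _∸_; _^_)
open import Data.Integer using (+_)
open import Data.Rational using (ℚ; 0ℚ; 1ℚ; _+_; _-_; -_; _⊔_; _⊓_; _≤_; _/_)
open import Data.List using (List; []; _∷_; foldr)
open import Data.Vec using (Vec; []; _∷_)

Sign : Set
Sign = Bool

signed : Sign → ℚ → ℚ
signed true  a = a
signed false a = - a

steps : ∀ {n} → ℚ → Vec Sign n → Vec ℚ n → List ℚ
steps s []       []       = []
steps s (e ∷ es) (a ∷ as) = (s + signed e a) ∷ steps (s + signed e a) es as

maxL : ℚ → List ℚ → ℚ
maxL x xs = foldr _⊔_ x xs

minL : ℚ → List ℚ → ℚ
minL x xs = foldr _⊓_ x xs

-- The range g(e,a) = max_{0≤k≤n} s_k - min_{0≤k≤n} s_k; s_0 = 0 is the fold seed.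
range : ∀ {n} → Vec Sign n → Vec ℚ n → ℚ
range es as = maxL 0ℚ (steps 0ℚ es as) - minL 0ℚ (steps 0ℚ es as)

data InUnit : ∀ {n} → Vec ℚ n → Set where
  []  : InUnit []
  cons : ∀ {n} {a : ℚ} {as : Vec ℚ n} → 0ℚ ≤ a → a ≤ 1ℚ → InUnit as → InUnit (a ∷ as)

-- The bound 2 - 1/(3·2^{m-1} - 1), for m ≥ 1.  Note 3·2^{m-1} ≥ 3, so
-- 3·2^{m-1} - 1 = suc (3·2^{m-1} ∸ 2) (written so the denominator is visibly nonzero).
bound : ℕ → ℚ
bound m = (+ 2 / 1) - (+ 1 / suc (3 ℕ.* 2 ^ (m ∸ 1) ∸ 2))

-- Scale by D = 3·2^(m−1) − 1 and take the steps
--   D, D−1, D, D−2, D, D−4, …, D, D−2^(m−1), D, D−2^(m−2), …, D, D−1, D   (divided by D).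
-- Every position of a signed walk along them is an integer multiple of 1/D, so it suffices
-- that the integer walk never stays inside an open window (a, a + 2D).  Call a point c-deep
-- when it is at distance at least c from both ends of the window.  If 3c ≤ D + 1, a step of
-- length D followed by a step of length D − c takes a c-deep point to a 2c-deep one (with
-- equal signs the two steps would leave the window), and symmetrically when the walk is read
-- backwards.  Going forward from 0, the point before the middle step D is therefore
-- 2^m-deep; going backward from the end, the point after it is 2^(m−1)-deep.  Two such
-- points cannot be D apart, because 3·2^(m−1) = D + 1.

module Submission where

open import Data.Bool using (true; false)
open import Data.Empty using (⊥-elim)
open import Data.Integer using (ℤ; +_; 0ℤ; 1ℤ)
open import Data.Product using (_×_; _,_; ∃₂)
open import Relation.Binary.PropositionalEquality
  using (_≡_; refl; sym; trans; cong; cong₂; subst; module ≡-Reasoning)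
open import Relation.Nullary using (¬_; yes; no)

open import Defs

module IntegerWalks where

  open import Data.Integer using (-1ℤ; _+_; _-_; _*_; _≤_; _⊔_; _⊓_; _≤?_; +≤+)
  open import Data.Integer.Properties
    using ( ≤-refl; ≤-reflexive; ≤-trans; +-mono-≤; *-monoˡ-≤-nonNeg; pos-*
          ; i≤j⇒0≤j-i; 0≤i-j⇒j≤i; ≰⇒>; i<j⇒suc[i]≤j
          ; i≤i⊔j; i≤j⇒i≤k⊔j; i⊓j≤i; i≤j⇒k⊓i≤j )
  open import Data.Integer.Tactic.RingSolver using (solve)
  open import Data.List using (List; []; _∷_; foldr)
  open import Data.Nat as ℕ using (ℕ; zero; suc; _^_)
  import Data.Nat.Properties as ℕ

  private
    variable
      c x y lo hi x₁ y₁ x₂ y₂ D : ℤ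

  sgn : Sign → ℤ
  sgn true  = 1ℤ
  sgn false = -1ℤ

  -- Linear arithmetic by certificates: the slack of the conclusion is a sum of slacks of
  -- hypotheses, an identity that `solve` checks.
  0≤slack-sum : x₁ ≤ y₁ → x₂ ≤ y₂ → 0ℤ ≤ (y₁ - x₁) + (y₂ - x₂)
  0≤slack-sum h₁ h₂ = +-mono-≤ (i≤j⇒0≤j-i h₁) (i≤j⇒0≤j-i h₂)

  ≤-by-slack : x₁ ≤ y₁ → y₁ - x₁ ≡ y - x → x ≤ y
  ≤-by-slack h eq = 0≤i-j⇒j≤i (subst (0ℤ ≤_) eq (i≤j⇒0≤j-i h))

  ≤-by-slack-sum : x₁ ≤ y₁ → x₂ ≤ y₂ → (y₁ - x₁) + (y₂ - x₂) ≡ y - x → x ≤ y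
  ≤-by-slack-sum h₁ h₂ eq = 0≤i-j⇒j≤i (subst (0ℤ ≤_) eq (0≤slack-sum h₁ h₂))

  slack-sum≢-1 : x₁ ≤ y₁ → x₂ ≤ y₂ → ¬ (y₁ - x₁) + (y₂ - x₂) ≡ -1ℤ
  slack-sum≢-1 h₁ h₂ eq with subst (0ℤ ≤_) eq (0≤slack-sum h₁ h₂)
  ... | ()

  module Window (D a : ℤ) where

    Deep : ℤ → ℤ → Set
    Deep c x = a + c ≤ x × x + c ≤ a + (D + D)

    deepen : ∀ c P s t → + 3 * c ≤ D + 1ℤ → Deep c P → Deep 1ℤ (P + sgn s * D) →
             Deep 1ℤ (P + sgn s * D + sgn t * (D - c)) →
             Deep (+ 2 * c) (P + sgn s * D + sgn t * (D - c))
    deepen c P true  true  _     (l₀ , _)  _         (_  , u₂) =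
      ⊥-elim (slack-sum≢-1 l₀ u₂ (solve (c ∷ P ∷ D ∷ a ∷ [])))
    deepen c P true  false small (l₀ , _)  (_  , u₁) _         =
      ≤-by-slack l₀ (solve (c ∷ P ∷ D ∷ a ∷ [])) ,
      ≤-by-slack-sum u₁ small (solve (c ∷ P ∷ D ∷ a ∷ []))
    deepen c P false true  small (_  , u₀) (l₁ , _)  _         =
      ≤-by-slack-sum l₁ small (solve (c ∷ P ∷ D ∷ a ∷ [])) ,
      ≤-by-slack u₀ (solve (c ∷ P ∷ D ∷ a ∷ []))
    deepen c P false false _     (_  , u₀) _         (l₂ , _)  =
      ⊥-elim (slack-sum≢-1 u₀ l₂ (solve (c ∷ P ∷ D ∷ a ∷ [])))

    deepen-backward : ∀ c Q s t → + 3 * c ≤ D + 1ℤ →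
                      Deep c (Q + sgn s * (D - c) + sgn t * D) →
                      Deep 1ℤ Q → Deep 1ℤ (Q + sgn s * (D - c)) → Deep (+ 2 * c) Q
    deepen-backward c Q true  true  _     (_  , u₀) (l₁ , _) _         =
      ⊥-elim (slack-sum≢-1 u₀ l₁ (solve (c ∷ Q ∷ D ∷ a ∷ [])))
    deepen-backward c Q true  false small (l₀ , _)  _        (_  , u₂) =
      ≤-by-slack l₀ (solve (c ∷ Q ∷ D ∷ a ∷ [])) ,
      ≤-by-slack-sum u₂ small (solve (c ∷ Q ∷ D ∷ a ∷ []))
    deepen-backward c Q false true  small (_  , u₀) _        (l₂ , _)  =
      ≤-by-slack-sum l₂ small (solve (c ∷ Q ∷ D ∷ a ∷ [])) ,
      ≤-by-slack u₀ (solve (c ∷ Q ∷ D ∷ a ∷ []))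
    deepen-backward c Q false false _     (l₀ , _)  (_ , u₁) _         =
      ⊥-elim (slack-sum≢-1 l₀ u₁ (solve (c ∷ Q ∷ D ∷ a ∷ [])))

    no-turn : ∀ c P s → D + 1ℤ ≤ + 3 * c → Deep (+ 2 * c) P → ¬ Deep c (P + sgn s * D)
    no-turn c P true  large (l₀ , _) (_ , u₁) =
      slack-sum≢-1 l₀ (+-mono-≤ u₁ large) (solve (c ∷ P ∷ D ∷ a ∷ []))
    no-turn c P false large (_ , u₀) (l₁ , _) =
      slack-sum≢-1 u₀ (+-mono-≤ l₁ large) (solve (c ∷ P ∷ D ∷ a ∷ []))

  bounded⇒1-deep : lo ≤ x → x ≤ hi → 1ℤ + (hi - lo) ≤ + 2 * D - 1ℤ →
                   Window.Deep D (lo - 1ℤ) 1ℤ x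
  bounded⇒1-deep {lo} {x} {hi} {D} lo≤x x≤hi narrow =
    ≤-by-slack lo≤x (solve (lo ∷ x ∷ [])) ,
    ≤-by-slack-sum x≤hi narrow (solve (lo ∷ x ∷ hi ∷ D ∷ []))

  0≤D-c≤D : 1ℤ ≤ c → + 3 * c ≤ D + 1ℤ → 0ℤ ≤ D - c × D - c ≤ D
  0≤D-c≤D {c} {D} 1≤c small = ≤-trans 0≤1 1≤D-c , ≤-by-slack (≤-trans 0≤1 1≤c) (solve (c ∷ D ∷ []))
    where
    0≤1 : 0ℤ ≤ 1ℤ
    0≤1 = +≤+ ℕ.z≤n
    1≤D-c : 1ℤ ≤ D - c
    1≤D-c = ≤-by-slack-sum small (+-mono-≤ 1≤c 1≤c) (solve (c ∷ D ∷ []))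

  -- Opened only here: their `_∷_` would make the variable lists given to `solve` ambiguous.
  open import Data.Vec using (Vec; []; _∷_)
  open import Data.List.Relation.Unary.All as All using (All; []; _∷_)
  open import Data.Vec.Relation.Unary.All as Vecᴬ using ([]; _∷_)

  walk : ∀ {n} → ℤ → Vec Sign n → Vec ℤ n → List ℤ
  walk x []       []       = []
  walk x (e ∷ es) (a ∷ as) = x + sgn e * a ∷ walk (x + sgn e * a) es as

  rangeℤ : ∀ {n} → Vec Sign n → Vec ℤ n → ℤ
  rangeℤ es as = foldr _⊔_ 0ℤ (walk 0ℤ es as) - foldr _⊓_ 0ℤ (walk 0ℤ es as)

  foldr-⊓-lower : ∀ x xs → All (foldr _⊓_ x xs ≤_) (x ∷ xs)
  foldr-⊓-lower x []       = ≤-refl ∷ []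
  foldr-⊓-lower x (y ∷ ys) with foldr-⊓-lower x ys
  ... | x≥ ∷ ys≥ = i≤j⇒k⊓i≤j y x≥ ∷ i⊓j≤i y _ ∷ All.map (i≤j⇒k⊓i≤j y) ys≥

  foldr-⊔-upper : ∀ x xs → All (_≤ foldr _⊔_ x xs) (x ∷ xs)
  foldr-⊔-upper x []       = ≤-refl ∷ []
  foldr-⊔-upper x (y ∷ ys) with foldr-⊔-upper x ys
  ... | x≤ ∷ ys≤ = i≤j⇒i≤k⊔j y x≤ ∷ i≤i⊔j y _ ∷ All.map (i≤j⇒i≤k⊔j y) ys≤

  module Zigzag (k : ℕ) (D : ℤ) (D+1≡3·2ᵏ : D + 1ℤ ≡ + 3 * + (2 ^ k)) where

    ascent : ∀ {t} (j i : ℕ) → Vec ℤ t → Vec ℤ (j ℕ.* 2 ℕ.+ t)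
    ascent zero    i tl = tl
    ascent (suc j) i tl = D ∷ D - + (2 ^ i) ∷ ascent j (suc i) tl

    descent : (j : ℕ) → Vec ℤ (suc (j ℕ.* 2))
    descent zero    = D ∷ []
    descent (suc j) = D ∷ D - + (2 ^ j) ∷ descent j

    zigzag : Vec ℤ (suc k ℕ.* 2 ℕ.+ suc (k ℕ.* 2))
    zigzag = ascent (suc k) 0 (descent k)

    3·2ⁱ≤D+1 : ∀ {i} → i ℕ.≤ k → + 3 * + (2 ^ i) ≤ D + 1ℤ
    3·2ⁱ≤D+1 i≤k = subst (_ ≤_) (sym D+1≡3·2ᵏ) (*-monoˡ-≤-nonNeg (+ 3) (+≤+ (ℕ.^-monoʳ-≤ 2 i≤k)))

    2ⁱ⁺¹ : ∀ i → + (2 ^ suc i) ≡ + 2 * + (2 ^ i)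
    2ⁱ⁺¹ i = pos-* 2 (2 ^ i)

    module _ (a : ℤ) where
      open Window D a

      deep-2ⁱ⁺¹ : ∀ i {x} → Deep (+ 2 * + (2 ^ i)) x → Deep (+ (2 ^ suc i)) x
      deep-2ⁱ⁺¹ i {x} = subst (λ c → Deep c x) (sym (2ⁱ⁺¹ i))

      ascent-deepens : ∀ j i P {t} (es : Vec Sign (j ℕ.* 2 ℕ.+ t)) (tl : Vec ℤ t) →
                       i ℕ.+ j ℕ.≤ suc k → Deep (+ (2 ^ i)) P →
                       All (Deep 1ℤ) (walk P es (ascent j i tl)) →
                       ∃₂ λ P′ es′ → Deep (+ (2 ^ (i ℕ.+ j))) P′ × All (Deep 1ℤ) (walk P′ es′ tl)
      ascent-deepens zero    i P es tl _ deep ds rewrite ℕ.+-identityʳ i = P , es , deep , ds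
      ascent-deepens (suc j) i P (s ∷ t ∷ es) tl i+j<1+k deep (d₁ ∷ d₂ ∷ ds)
        rewrite ℕ.+-suc i j =
        ascent-deepens j (suc i) _ es tl i+j<1+k
          (deep-2ⁱ⁺¹ i (deepen (+ (2 ^ i)) P s t (3·2ⁱ≤D+1 i≤k) deep d₁ d₂)) ds
        where i≤k = ℕ.m+n≤o⇒m≤o i (ℕ.s≤s⁻¹ i+j<1+k)

      descent-deepens : ∀ j Q e (es : Vec Sign (j ℕ.* 2)) → j ℕ.≤ k →
                        All (Deep 1ℤ) (walk Q (e ∷ es) (descent j)) →
                        Deep (+ (2 ^ j)) (Q + sgn e * D)
      descent-deepens zero    Q e []           _   (d ∷ []) = d
      descent-deepens (suc j) Q e (s ∷ t ∷ es) j<k (d₁ ∷ d₂ ∷ ds) =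
        deep-2ⁱ⁺¹ j (deepen-backward (+ (2 ^ j)) (Q + sgn e * D) s t (3·2ⁱ≤D+1 (ℕ.<⇒≤ j<k))
          (descent-deepens j _ t es (ℕ.<⇒≤ j<k) ds) d₁ d₂)

      zigzag-leaves-window : (es : Vec Sign (suc k ℕ.* 2 ℕ.+ suc (k ℕ.* 2))) →
                             ¬ All (Deep 1ℤ) (0ℤ ∷ walk 0ℤ es zigzag)
      zigzag-leaves-window es (d₀ ∷ ds)
        with ascent-deepens (suc k) 0 0ℤ es (descent k) ℕ.≤-refl d₀ ds
      ... | P , e ∷ es′ , deep , ds′ =
        no-turn (+ (2 ^ k)) P e (≤-reflexive D+1≡3·2ᵏ) (subst (λ c → Deep c P) (2ⁱ⁺¹ k) deep)
          (descent-deepens k P e es′ ℕ.≤-refl ds′)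

    2D-1≤rangeℤ : (es : Vec Sign (suc k ℕ.* 2 ℕ.+ suc (k ℕ.* 2))) →
                  + 2 * D - 1ℤ ≤ rangeℤ es zigzag
    2D-1≤rangeℤ es with + 2 * D - 1ℤ ≤? rangeℤ es zigzag
    ... | yes wide  = wide
    ... | no narrow = ⊥-elim (zigzag-leaves-window (lowest - 1ℤ) es
                        (All.zipWith inside (foldr-⊓-lower 0ℤ zs , foldr-⊔-upper 0ℤ zs)))
      where
      zs = walk 0ℤ es zigzag
      lowest = foldr _⊓_ 0ℤ zs
      highest = foldr _⊔_ 0ℤ zs
      inside : ∀ {y} → lowest ≤ y × y ≤ highest → Window.Deep D (lowest - 1ℤ) 1ℤ y
      inside (l , u) = bounded⇒1-deep {D = D} l u (i<j⇒suc[i]≤j (≰⇒> narrow))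

    InRange : ℤ → Set
    InRange a = 0ℤ ≤ a × a ≤ D

    InRange-D-2ⁱ : ∀ {i} → i ℕ.≤ k → InRange (D - + (2 ^ i))
    InRange-D-2ⁱ {i} i≤k = 0≤D-c≤D (+≤+ (ℕ.m^n>0 2 i)) (3·2ⁱ≤D+1 i≤k)

    InRange-D : InRange D
    InRange-D with InRange-D-2ⁱ {0} ℕ.z≤n
    ... | 0≤D-1 , D-1≤D = ≤-trans 0≤D-1 D-1≤D , ≤-refl

    ascent-in-range : ∀ {t} j i (tl : Vec ℤ t) → i ℕ.+ j ℕ.≤ suc k →
                      Vecᴬ.All InRange tl → Vecᴬ.All InRange (ascent j i tl)
    ascent-in-range zero    i tl _        tl-in-range = tl-in-range
    ascent-in-range (suc j) i tl i+j<1+k tl-in-range rewrite ℕ.+-suc i j =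
      InRange-D ∷ InRange-D-2ⁱ (ℕ.m+n≤o⇒m≤o i (ℕ.s≤s⁻¹ i+j<1+k)) ∷
      ascent-in-range j (suc i) tl i+j<1+k tl-in-range

    descent-in-range : ∀ j → j ℕ.≤ k → Vecᴬ.All InRange (descent j)
    descent-in-range zero    _   = InRange-D ∷ []
    descent-in-range (suc j) j<k =
      InRange-D ∷ InRange-D-2ⁱ (ℕ.<⇒≤ j<k) ∷ descent-in-range j (ℕ.<⇒≤ j<k)

    zigzag-in-range : Vecᴬ.All InRange zigzag
    zigzag-in-range = ascent-in-range (suc k) 0 (descent k) ℕ.≤-refl (descent-in-range k ℕ.≤-refl)

-- Imported only here: their `_*_` and `_≤_` would clash with the integer ones above.
open import Data.Nat using (ℕ; NonZero; _*_; _∸_)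
open import Data.Rational using (ℚ; _≤_)
open import Data.Vec using (Vec)
open import Data.Product using (∃; _×_)

import Data.Integer as ℤ
import Data.Integer.Properties as ℤ
open import Data.List as List using (_∷_)
open import Data.Nat as ℕ using (suc)
import Data.Nat.Properties as ℕ
open import Data.Nat.Tactic.RingSolver using (solve-∀)
open import Data.Rational using (0ℚ; 1ℚ; _+_; _-_; -_; _/_; _⊔_; _⊓_; toℚᵘ; fromℚᵘ)
import Data.Rational.Properties as ℚ
open import Data.Rational.Unnormalised as ℚᵘ using (mkℚᵘ; *≡*; *≤*)
import Data.Rational.Unnormalised.Properties as ℚᵘ
open import Data.Sum using (inj₁; inj₂)
open import Data.Vec as Vec using ([]; _∷_)
open import Data.Vec.Relation.Unary.All as Vecᴬ using ([]; _∷_)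
open import Relation.Binary.Core using (_Preserves_⟶_)

open IntegerWalks using (sgn; walk; rangeℤ; module Zigzag)

fromℚᵘ-homo-+ : ∀ p q → fromℚᵘ (p ℚᵘ.+ q) ≡ fromℚᵘ p + fromℚᵘ q
fromℚᵘ-homo-+ p q = begin
  fromℚᵘ (p ℚᵘ.+ q)
    ≡⟨ ℚ.fromℚᵘ-cong (ℚᵘ.+-cong (ℚᵘ.≃-sym (ℚ.toℚᵘ-fromℚᵘ p)) (ℚᵘ.≃-sym (ℚ.toℚᵘ-fromℚᵘ q))) ⟩
  fromℚᵘ (toℚᵘ (fromℚᵘ p) ℚᵘ.+ toℚᵘ (fromℚᵘ q))
    ≡⟨ ℚ.fromℚᵘ-cong (ℚᵘ.≃-sym (ℚ.toℚᵘ-homo-+ (fromℚᵘ p) (fromℚᵘ q))) ⟩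
  fromℚᵘ (toℚᵘ (fromℚᵘ p + fromℚᵘ q))
    ≡⟨ ℚ.fromℚᵘ-toℚᵘ _ ⟩
  fromℚᵘ p + fromℚᵘ q ∎
  where open ≡-Reasoning

fromℚᵘ-homo‿- : ∀ p → fromℚᵘ (ℚᵘ.- p) ≡ - fromℚᵘ p
fromℚᵘ-homo‿- p = begin
  fromℚᵘ (ℚᵘ.- p)                ≡⟨ ℚ.fromℚᵘ-cong (ℚᵘ.-‿cong (ℚᵘ.≃-sym (ℚ.toℚᵘ-fromℚᵘ p))) ⟩
  fromℚᵘ (ℚᵘ.- toℚᵘ (fromℚᵘ p))  ≡⟨ ℚ.fromℚᵘ-cong (ℚᵘ.≃-sym (ℚ.toℚᵘ-homo‿- (fromℚᵘ p))) ⟩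
  fromℚᵘ (toℚᵘ (- fromℚᵘ p))     ≡⟨ ℚ.fromℚᵘ-toℚᵘ _ ⟩
  - fromℚᵘ p                     ∎
  where open ≡-Reasoning

fromℚᵘ-mono-≤ : ∀ {p q} → p ℚᵘ.≤ q → fromℚᵘ p ≤ fromℚᵘ q
fromℚᵘ-mono-≤ {p} {q} p≤q = ℚ.toℚᵘ-cancel-≤
  (ℚᵘ.≤-respˡ-≃ (ℚᵘ.≃-sym (ℚ.toℚᵘ-fromℚᵘ p)) (ℚᵘ.≤-respʳ-≃ (ℚᵘ.≃-sym (ℚ.toℚᵘ-fromℚᵘ q)) p≤q))

mkℚᵘ-+ : ∀ d i j → mkℚᵘ (i ℤ.+ j) d ℚᵘ.≃ mkℚᵘ i d ℚᵘ.+ mkℚᵘ j d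
mkℚᵘ-+ d i j = *≡* (begin
  (i ℤ.+ j) ℤ.* + (suc d ℕ.* suc d)  ≡⟨ cong ((i ℤ.+ j) ℤ.*_) (ℤ.pos-* (suc d) (suc d)) ⟩
  (i ℤ.+ j) ℤ.* (D ℤ.* D)            ≡⟨ sym (ℤ.*-assoc (i ℤ.+ j) D D) ⟩
  (i ℤ.+ j) ℤ.* D ℤ.* D              ≡⟨ cong (ℤ._* D) (ℤ.*-distribʳ-+ D i j) ⟩
  (i ℤ.* D ℤ.+ j ℤ.* D) ℤ.* D        ∎)
  where
  open ≡-Reasoning
  D = + suc d

mkℚᵘ-*-cancel : ∀ d i → mkℚᵘ (i ℤ.* + suc d) d ℚᵘ.≃ mkℚᵘ i 0
mkℚᵘ-*-cancel d i = *≡* (ℤ.*-identityʳ (i ℤ.* + suc d))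

mkℚᵘ-mono-≤ : ∀ d {i j} → i ℤ.≤ j → mkℚᵘ i d ℚᵘ.≤ mkℚᵘ j d
mkℚᵘ-mono-≤ d i≤j = *≤* (ℤ.*-monoʳ-≤-nonNeg (+ suc d) i≤j)

module _ {f : ℤ → ℚ} (f-mono : f Preserves ℤ._≤_ ⟶ _≤_) where

  mono-distrib-⊔ : ∀ i j → f (i ℤ.⊔ j) ≡ f i ⊔ f j
  mono-distrib-⊔ i j with ℤ.≤-total i j
  ... | inj₁ i≤j = trans (cong f (ℤ.i≤j⇒i⊔j≡j i≤j)) (sym (ℚ.p≤q⇒p⊔q≡q (f-mono i≤j)))
  ... | inj₂ j≤i = trans (cong f (ℤ.i≥j⇒i⊔j≡i j≤i)) (sym (ℚ.p≥q⇒p⊔q≡p (f-mono j≤i)))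

  mono-distrib-⊓ : ∀ i j → f (i ℤ.⊓ j) ≡ f i ⊓ f j
  mono-distrib-⊓ i j with ℤ.≤-total i j
  ... | inj₁ i≤j = trans (cong f (ℤ.i≤j⇒i⊓j≡i i≤j)) (sym (ℚ.p≤q⇒p⊓q≡p (f-mono i≤j)))
  ... | inj₂ j≤i = trans (cong f (ℤ.i≥j⇒i⊓j≡j j≤i)) (sym (ℚ.p≥q⇒p⊓q≡q (f-mono j≤i)))

  maxL-map : ∀ x xs → maxL (f x) (List.map f xs) ≡ f (List.foldr ℤ._⊔_ x xs)
  maxL-map x List.[]  = refl
  maxL-map x (y ∷ ys) = trans (cong (f y ⊔_) (maxL-map x ys)) (sym (mono-distrib-⊔ y _))

  minL-map : ∀ x xs → minL (f x) (List.map f xs) ≡ f (List.foldr ℤ._⊓_ x xs)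
  minL-map x List.[]  = refl
  minL-map x (y ∷ ys) = trans (cong (f y ⊓_) (minL-map x ys)) (sym (mono-distrib-⊓ y _))

module Scaled (d : ℕ) where

  -- i / (d + 1), through ℚᵘ so that the `fromℚᵘ` lemmas above apply.
  ⟦_⟧ : ℤ → ℚ
  ⟦ i ⟧ = fromℚᵘ (mkℚᵘ i d)

  ⟦i+j⟧ : ∀ i j → ⟦ i ℤ.+ j ⟧ ≡ ⟦ i ⟧ + ⟦ j ⟧
  ⟦i+j⟧ i j = trans (ℚ.fromℚᵘ-cong (mkℚᵘ-+ d i j)) (fromℚᵘ-homo-+ (mkℚᵘ i d) (mkℚᵘ j d))

  ⟦-i⟧ : ∀ i → ⟦ ℤ.- i ⟧ ≡ - ⟦ i ⟧
  ⟦-i⟧ i = fromℚᵘ-homo‿- (mkℚᵘ i d)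

  ⟦i-j⟧ : ∀ i j → ⟦ i ℤ.- j ⟧ ≡ ⟦ i ⟧ - ⟦ j ⟧
  ⟦i-j⟧ i j = trans (⟦i+j⟧ i (ℤ.- j)) (cong (_+_ ⟦ i ⟧) (⟦-i⟧ j))

  ⟦⟧-mono-≤ : ⟦_⟧ Preserves ℤ._≤_ ⟶ _≤_
  ⟦⟧-mono-≤ i≤j = fromℚᵘ-mono-≤ (mkℚᵘ-mono-≤ d i≤j)

  ⟦0⟧ : ⟦ 0ℤ ⟧ ≡ 0ℚ
  ⟦0⟧ = ℚ.0/n≡0 (suc d)

  ⟦i*D⟧ : ∀ i → ⟦ i ℤ.* + suc d ⟧ ≡ i / 1
  ⟦i*D⟧ i = ℚ.fromℚᵘ-cong (mkℚᵘ-*-cancel d i)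

  ⟦D⟧ : ⟦ + suc d ⟧ ≡ 1ℚ
  ⟦D⟧ = trans (cong ⟦_⟧ (sym (ℤ.*-identityˡ (+ suc d)))) (⟦i*D⟧ 1ℤ)

  ⟦2D-1⟧ : ⟦ + 2 ℤ.* + suc d ℤ.- 1ℤ ⟧ ≡ + 2 / 1 - + 1 / suc d
  ⟦2D-1⟧ = trans (⟦i-j⟧ (+ 2 ℤ.* + suc d) 1ℤ) (cong (_- ⟦ 1ℤ ⟧) (⟦i*D⟧ (+ 2)))

  ⟦⟧-step : ∀ x e a → ⟦ x ⟧ + signed e ⟦ a ⟧ ≡ ⟦ x ℤ.+ sgn e ℤ.* a ⟧
  ⟦⟧-step x e a = trans (cong (_+_ ⟦ x ⟧) (sym (⟦sgn⟧ e))) (sym (⟦i+j⟧ x (sgn e ℤ.* a)))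
    where
    ⟦sgn⟧ : ∀ e → ⟦ sgn e ℤ.* a ⟧ ≡ signed e ⟦ a ⟧
    ⟦sgn⟧ true  = cong ⟦_⟧ (ℤ.*-identityˡ a)
    ⟦sgn⟧ false = trans (cong ⟦_⟧ (ℤ.-1*i≡-i a)) (⟦-i⟧ a)

  steps-⟦⟧ : ∀ {n} x (es : Vec Sign n) as →
             steps ⟦ x ⟧ es (Vec.map ⟦_⟧ as) ≡ List.map ⟦_⟧ (walk x es as)
  steps-⟦⟧ x []       []       = refl
  steps-⟦⟧ x (e ∷ es) (a ∷ as) rewrite ⟦⟧-step x e a =
    cong (⟦ x ℤ.+ sgn e ℤ.* a ⟧ ∷_) (steps-⟦⟧ _ es as)

  range-⟦⟧ : ∀ {n} (es : Vec Sign n) as → range es (Vec.map ⟦_⟧ as) ≡ ⟦ rangeℤ es as ⟧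
  range-⟦⟧ es as = begin
    maxL 0ℚ (steps 0ℚ es ⟦as⟧) - minL 0ℚ (steps 0ℚ es ⟦as⟧)
      ≡⟨ cong (λ q → maxL q (steps q es ⟦as⟧) - minL q (steps q es ⟦as⟧)) (sym ⟦0⟧) ⟩
    maxL ⟦ 0ℤ ⟧ (steps ⟦ 0ℤ ⟧ es ⟦as⟧) - minL ⟦ 0ℤ ⟧ (steps ⟦ 0ℤ ⟧ es ⟦as⟧)
      ≡⟨ cong (λ qs → maxL ⟦ 0ℤ ⟧ qs - minL ⟦ 0ℤ ⟧ qs) (steps-⟦⟧ 0ℤ es as) ⟩
    maxL ⟦ 0ℤ ⟧ (List.map ⟦_⟧ zs) - minL ⟦ 0ℤ ⟧ (List.map ⟦_⟧ zs)
      ≡⟨ cong₂ _-_ (maxL-map ⟦⟧-mono-≤ 0ℤ zs) (minL-map ⟦⟧-mono-≤ 0ℤ zs) ⟩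
    ⟦ highest ⟧ - ⟦ lowest ⟧
      ≡⟨ sym (⟦i-j⟧ highest lowest) ⟩
    ⟦ rangeℤ es as ⟧ ∎
    where
    open ≡-Reasoning
    ⟦as⟧ = Vec.map ⟦_⟧ as
    zs = walk 0ℤ es as
    highest = List.foldr ℤ._⊔_ 0ℤ zs
    lowest = List.foldr ℤ._⊓_ 0ℤ zs

  InUnit-⟦⟧ : ∀ {n} {as : Vec ℤ n} → Vecᴬ.All (λ a → 0ℤ ℤ.≤ a × a ℤ.≤ + suc d) as →
              InUnit (Vec.map ⟦_⟧ as)
  InUnit-⟦⟧ []                             = []
  InUnit-⟦⟧ {as = a ∷ _} ((0≤a , a≤D) ∷ rest) =
    cons (subst (_≤ ⟦ a ⟧) ⟦0⟧ (⟦⟧-mono-≤ 0≤a)) (subst (⟦ a ⟧ ≤_) ⟦D⟧ (⟦⟧-mono-≤ a≤D))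
         (InUnit-⟦⟧ rest)

D+1≡3·2ᵏ : ∀ k → + suc (3 * 2 ℕ.^ k ∸ 2) ℤ.+ 1ℤ ≡ + 3 ℤ.* + (2 ℕ.^ k)
D+1≡3·2ᵏ k = begin
  + suc (3 * 2 ℕ.^ k ∸ 2) ℤ.+ 1ℤ   ≡⟨ sym (ℤ.pos-+ (suc (3 * 2 ℕ.^ k ∸ 2)) 1) ⟩
  + (suc (3 * 2 ℕ.^ k ∸ 2) ℕ.+ 1)  ≡⟨ cong +_ (ℕ.+-comm (suc (3 * 2 ℕ.^ k ∸ 2)) 1) ⟩
  + (2 ℕ.+ (3 * 2 ℕ.^ k ∸ 2))      ≡⟨ cong +_ (ℕ.m+[n∸m]≡n 2≤3·2ᵏ) ⟩
  + (3 * 2 ℕ.^ k)                  ≡⟨ ℤ.pos-* 3 (2 ℕ.^ k) ⟩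
  + 3 ℤ.* + (2 ℕ.^ k)              ∎
  where
  open ≡-Reasoning
  2≤3·2ᵏ : 2 ℕ.≤ 3 * 2 ℕ.^ k
  2≤3·2ᵏ = ℕ.≤-trans (ℕ.n≤1+n 2) (ℕ.*-monoʳ-≤ 3 (ℕ.m^n>0 2 k))

-- The right-hand side is what `4 * suc k ∸ 1` reduces to.
zigzag-length : ∀ k → suc k * 2 ℕ.+ suc (k * 2) ≡ k ℕ.+ 3 * suc k
zigzag-length = solve-∀

theorem2 : (m : ℕ) → .{{_ : NonZero m}} →
    ∃ λ (as : Vec ℚ (4 * m ∸ 1)) → InUnit as ×
      ((es : Vec Sign (4 * m ∸ 1)) → bound m ≤ range es as)
theorem2 (suc k) =
  subst (λ n → ∃ λ (as : Vec ℚ n) → InUnit as × ((es : Vec Sign n) → bound (suc k) ≤ range es as))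
    (zigzag-length k) (Vec.map ⟦_⟧ zigzag , InUnit-⟦⟧ zigzag-in-range , bound≤range)
  where
  d = 3 * 2 ℕ.^ k ∸ 2
  open Scaled d
  open Zigzag k (+ suc d) (D+1≡3·2ᵏ k)
  bound≤range : (es : Vec Sign _) → bound (suc k) ≤ range es (Vec.map ⟦_⟧ zigzag)
  bound≤range es = begin
    bound (suc k)                   ≡⟨ sym ⟦2D-1⟧ ⟩
    ⟦ + 2 ℤ.* + suc d ℤ.- 1ℤ ⟧      ≤⟨ ⟦⟧-mono-≤ (2D-1≤rangeℤ es) ⟩
    ⟦ rangeℤ es zigzag ⟧            ≡⟨ sym (range-⟦⟧ es zigzag) ⟩
    range es (Vec.map ⟦_⟧ zigzag)   ∎
    where open ℚ.≤-Reasoning
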